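{- Let $\alpha,\beta\in\omega^\omega$ both be measurable. (i) If $\mu(\alpha)<\mu(\beta)$ and $\mathcal{H}_\alpha\subseteq\mathcal{H}_\beta$, then one may find a real $x$ with $x\in\mathcal{H}_\beta$ and $x\notin\mathcal{H}_\alpha$. (ii) If $\mathcal{H}_\beta\subseteq\mathcal{H}_\alpha$, then $\mu(\beta)\le\mu(\alpha)$; and if $\mathcal{H}_\beta=\mathcal{H}_\alpha$, then $\mu(\beta)=\mu(\alpha)$.
   Context: Setting: intuitionistic mathematics (intuitionistic logic; "one may find" means constructive existence), with countable choice. Reals are shrinking, dwindling sequences of pairs of rationals, with $x<y\iff\exists n[x''(n)<y'(n)]$. Let $(q_0,r_0),(q_1,r_1),\dots$ be a fixed enumeration of all pairs $(q,r)$ of rationals with $q\le r$. For a finite sequence $a$ of length $n$, $\mathcal{H}_a=\{x\in\mathcal{R}\mid\exists j<n[q_{a(j)}<x<r_{a(j)}]\}$; for $\alpha\in\omega^\omega$, $\mathcal{H}_\alpha=\{x\in\mathcal{R}\mid\exists j[q_{\alpha(j)}<x<r_{\alpha(j)}]\}$. A finite sequence $b$ of length $n$ is neatly increasing if $q_{b(j)}<r_{b(j)}$ for all $j<n$ and $r_{b(j)}\le q_{b(j+1)}$ for all $j<n-1$; for each finite $a$ there is exactly one neatly increasing $b$ with $\mathcal{H}_a=\mathcal{H}_b$, and $\mu(a):=\sum_{j<\mathrm{length}(b)}(r_{b(j)}-q_{b(j)})$ for that $b$. $\alpha$ is measurable iff $\mu(\alpha):=\lim_{n\to\infty}\mu(\overline{\alpha}n)$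 exists (as a real), where $\overline{\alpha}n=\langle\alpha(0),\dots,\alpha(n-1)\rangle$. -}

module Defs where

open import Data.Nat as ℕ using (ℕ; zero; suc)
open import Data.Nat.Properties using (m^n≢0)
open import Data.Integer using (+_)
open import Data.Rational using (ℚ; _<_; _≤_; _+_; _-_; _⊓_; _⊔_; _/_; 0ℚ)
open import Data.Rational.Properties using (_≤?_)
open import Data.Product using (Σ; ∃; _×_; _,_; proj₁; proj₂)
open import Data.List using (List; []; _∷_; map; upTo; foldr)
open import Data.List.Relation.Unary.Any using (Any)
open import Data.Unit using (⊤)
open import Relation.Nullary using (¬_; yes; no)
open import Relation.Binary.PropositionalEquality using (_≡_)

-- Reals: shrinking, dwindling sequences of pairs of rationals.
-- x'(n) = lo x n, x''(n) = hi x n.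

2^-_ : ℕ → ℚ
2^- m = (+ 1 / (2 ℕ.^ m)) {{m^n≢0 2 m}}

record ℝ : Set where
  field
    lo : ℕ → ℚ
    hi : ℕ → ℚ
    lo≤hi     : ∀ n → lo n ≤ hi n
    lo-mono   : ∀ n → lo n ≤ lo (suc n)
    hi-anti   : ∀ n → hi (suc n) ≤ hi n
    dwindling : ∀ m → ∃ λ n → hi n - lo n < 2^- m
open ℝ public

_<ℝ_ : ℝ → ℝ → Set
x <ℝ y = ∃ λ n → hi x n < lo y n

_≤ℝ_ : ℝ → ℝ → Set
x ≤ℝ y = ¬ (y <ℝ x)

_=ℝ_ : ℝ → ℝ → Set
x =ℝ y = ¬ (x <ℝ y) × ¬ (y <ℝ x)

_<ℚℝ_ : ℚ → ℝ → Set
q <ℚℝ x = ∃ λ n → q < lo x n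

_<ℝℚ_ : ℝ → ℚ → Set
x <ℝℚ r = ∃ λ n → hi x n < r

record Enumeration : Set where
  field
    pair     : ℕ → ℚ × ℚ
    ordered  : ∀ n → proj₁ (pair n) ≤ proj₂ (pair n)
    complete : ∀ q r → q ≤ r → ∃ λ n → pair n ≡ (q , r)
open Enumeration public

module _ (E : Enumeration) where

  q_ r_ : ℕ → ℚ
  q_ n = proj₁ (pair E n)
  r_ n = proj₂ (pair E n)

  InI : ℕ → ℝ → Set
  InI i x = (q_ i <ℚℝ x) × (x <ℝℚ r_ i)

  H-fin : List ℕ → ℝ → Set
  H-fin a x = Any (λ i → InI i x) a

  H : (ℕ → ℕ) → ℝ → Set
  H α x = ∃ λ j → InI (α j) x

  NeatlyIncreasing : List ℕ → Set
  NeatlyIncreasing [] = ⊤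
  NeatlyIncreasing (i ∷ []) = q_ i < r_ i
  NeatlyIncreasing (i ∷ j ∷ b) = q_ i < r_ i × r_ i ≤ q_ j × NeatlyIncreasing (j ∷ b)

-- The neatly increasing normal form, computed on the intervals
-- themselves: insert an interval into a sorted list of pairwise
-- "neatly" separated nonempty open intervals, merging overlaps.

insertI : ℚ × ℚ → List (ℚ × ℚ) → List (ℚ × ℚ)
insertI (q , r) [] = (q , r) ∷ []
insertI (q , r) ((q' , r') ∷ rest) with r ≤? q'
... | yes _ = (q , r) ∷ (q' , r') ∷ rest
... | no _ with r' ≤? q
...   | yes _ = (q' , r') ∷ insertI (q , r) rest
...   | no _  = insertI (q ⊓ q' , r ⊔ r') rest

normalise : List (ℚ × ℚ) → List (ℚ × ℚ)
normalise [] = []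
normalise ((q , r) ∷ xs) with r ≤? q
... | yes _ = normalise xs
... | no _  = insertI (q , r) (normalise xs)

totalLength : List (ℚ × ℚ) → ℚ
totalLength = foldr (λ p s → (proj₂ p - proj₁ p) + s) 0ℚ

module _ (E : Enumeration) where

  μ-fin : List ℕ → ℚ
  μ-fin a = totalLength (normalise (map (pair E) a))

  initSeg : (ℕ → ℕ) → ℕ → List ℕ
  initSeg α n = map α (upTo n)

  IsMeasure : (ℕ → ℕ) → ℝ → Set
  IsMeasure α m = ∀ k → ∃ λ N → ∀ n → N ℕ.≤ n →
    ((μ-fin (initSeg α n) - 2^- k) <ℚℝ m) × (m <ℝℚ (μ-fin (initSeg α n) + 2^- k))

-- Suppose μ(α) < μ(β). For large N and M the intervals of β̄N exceed those of ᾱM in total length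
-- by a fixed margin, so by pigeonhole some interval of β̄N has a part of known positive length that
-- ᾱM does not cover. Bisect it repeatedly, each time keeping a half of which at least half as much
-- is uncovered, and then enlarge M past a Cauchy modulus of μ(ᾱM), so that the enlargement covers
-- less than half of that again. The nested halves shrink to a real in H_β that lies in no interval
-- of α, since such an interval would eventually contain a whole half. Part (ii) follows, because
-- H_β ⊆ H_α excludes μ(α) < μ(β).
--
-- Lengths of finite unions are computed by inclusion–exclusion inside a window interval, which
-- makes them additive in the window; additivity drives all the estimates.

module Submission where

open import Algebra.Bundles using (CommutativeMonoid)
import Algebra.Properties.CommutativeSemigroup as CommutativeSemigroupProperties
open import Data.Empty using (⊥-elim)
open import Data.List using (List; []; _∷_; _++_; map; length; foldr; replicate)
open import Data.List.Membership.Propositional using (_∈_; find)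
open import Data.List.Membership.Propositional.Properties using (∈-map⁺; ∈-map⁻; ∈-upTo⁺; ∈-upTo⁻)
open import Data.List.Relation.Unary.All as All using (All; []; _∷_)
import Data.List.Relation.Unary.All.Properties as All
open import Data.List.Relation.Unary.Any as Any using (Any; here; there)
import Data.List.Relation.Unary.Any.Properties as Any
open import Data.Nat as ℕ using (ℕ; zero; suc)
import Data.Nat.Properties as ℕₚ
open import Data.Product using (Σ; ∃; _×_; _,_; proj₁; proj₂)
open import Data.Rational
open import Data.Rational.Properties
open import Data.Rational.Solver using (module +-*-Solver)
import Data.Rational.Unnormalised as ℚᵘ
import Data.Rational.Unnormalised.Properties as ℚᵘₚ
open import Data.Sum using (_⊎_; inj₁; inj₂; [_,_]′)
open import Data.Unit using (⊤; tt)
open import Function using (_∘_)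
open import Relation.Binary.PropositionalEquality
open import Relation.Nullary using (¬_; yes; no)

open import Defs

module ⊓ = CommutativeSemigroupProperties ⊓-commutativeSemigroup
module ⊔ = CommutativeSemigroupProperties ⊔-commutativeSemigroup
module + = CommutativeSemigroupProperties (CommutativeMonoid.commutativeSemigroup +-0-commutativeMonoid)
open +-*-Solver using (solve; _:+_; _:-_; _:*_; _:=_; con)

p≤q⇒0≤q-p : ∀ {p q} → p ≤ q → 0ℚ ≤ q - p
p≤q⇒0≤q-p {p} {q} p≤q = subst (_≤ q - p) (+-inverseʳ p) (+-monoˡ-≤ (- p) p≤q)

p<q⇒0<q-p : ∀ {p q} → p < q → 0ℚ < q - p
p<q⇒0<q-p {p} {q} p<q = subst (_< q - p) (+-inverseʳ p) (+-monoˡ-< (- p) p<q)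

p≤q⇒p-q≤0 : ∀ {p q} → p ≤ q → p - q ≤ 0ℚ
p≤q⇒p-q≤0 {p} {q} p≤q = subst (p - q ≤_) (+-inverseʳ q) (+-monoˡ-≤ (- q) p≤q)

q-p+p≡q : ∀ p q → (q - p) + p ≡ q
q-p+p≡q = solve 2 (λ p q → (q :- p) :+ p := q) refl

0≤q-p⇒p≤q : ∀ {p q} → 0ℚ ≤ q - p → p ≤ q
0≤q-p⇒p≤q {p} {q} h = subst₂ _≤_ (+-identityˡ p) (q-p+p≡q p q) (+-monoˡ-≤ p h)

0<q-p⇒p<q : ∀ {p q} → 0ℚ < q - p → p < q
0<q-p⇒p<q {p} {q} h = subst₂ _<_ (+-identityˡ p) (q-p+p≡q p q) (+-monoˡ-< p h)

p+q-p≡q : ∀ p q → (p + q) - p ≡ q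
p+q-p≡q = solve 2 (λ p q → (p :+ q) :- p := q) refl

p≤p+q : ∀ p {q} → 0ℚ ≤ q → p ≤ p + q
p≤p+q p {q} 0≤q = 0≤q-p⇒p≤q (subst (0ℚ ≤_) (sym (p+q-p≡q p q)) 0≤q)

p<p+q : ∀ p {q} → 0ℚ < q → p < p + q
p<p+q p {q} 0<q = 0<q-p⇒p<q (subst (0ℚ <_) (sym (p+q-p≡q p q)) 0<q)

p-[p-q]≡q : ∀ p q → p - (p - q) ≡ q
p-[p-q]≡q = solve 2 (λ p q → p :- (p :- q) := q) refl

p-q≤p : ∀ p {q} → 0ℚ ≤ q → p - q ≤ p
p-q≤p p {q} 0≤q = 0≤q-p⇒p≤q (subst (0ℚ ≤_) (sym (p-[p-q]≡q p q)) 0≤q)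

p-q<p : ∀ p {q} → 0ℚ < q → p - q < p
p-q<p p {q} 0<q = 0<q-p⇒p<q (subst (0ℚ <_) (sym (p-[p-q]≡q p q)) 0<q)

-‿mono-≤ : ∀ {p p′ q q′} → p ≤ p′ → q′ ≤ q → p - q ≤ p′ - q′
-‿mono-≤ p≤p′ q′≤q = +-mono-≤ p≤p′ (neg-antimono-≤ q′≤q)

p≤q+r⇒p-q≤r : ∀ {p q r} → p ≤ q + r → p - q ≤ r
p≤q+r⇒p-q≤r {p} {q} {r} h =
  subst (p - q ≤_) (p+q-p≡q q r) (-‿mono-≤ h (≤-refl {q}))

p≤q+r⇒p-r≤q : ∀ {p q r} → p ≤ q + r → p - r ≤ q
p≤q+r⇒p-r≤q {p} {q} {r} h = p≤q+r⇒p-q≤r (subst (p ≤_) (+-comm q r) h)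

p<q+r⇒p-q<r : ∀ {p q r} → p < q + r → p - q < r
p<q+r⇒p-q<r {p} {q} {r} h =
  subst (p - q <_) (p+q-p≡q q r) (+-monoˡ-< (- q) h)

p<q+r⇒p-r<q : ∀ {p q r} → p < q + r → p - r < q
p<q+r⇒p-r<q {p} {q} {r} h = p<q+r⇒p-q<r (subst (p <_) (+-comm q r) h)

p-r<q⇒p<q+r : ∀ {p q r} → p - r < q → p < q + r
p-r<q⇒p<q+r {p} {q} {r} h = subst (_< q + r) (q-p+p≡q r p) (+-monoˡ-< r h)

-‿mono-<-≤ : ∀ {p p′ q q′} → p < p′ → q′ ≤ q → p - q < p′ - q′
-‿mono-<-≤ p<p′ q′≤q = +-mono-<-≤ p<p′ (neg-antimono-≤ q′≤q)

p+q≡r⇒p≡r-q : ∀ p q {r} → p + q ≡ r → p ≡ r - q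
p+q≡r⇒p≡r-q p q refl = solve 2 (λ p q → p := (p :+ q) :- q) refl p q

p≡p+p⇒p≡0 : ∀ p → p ≡ p + p → p ≡ 0ℚ
p≡p+p⇒p≡0 p h = begin
  p             ≡⟨ solve 1 (λ p → p := (p :+ p) :- p) refl p ⟩
  (p + p) - p   ≡⟨ cong (_- p) (sym h) ⟩
  p - p         ≡⟨ +-inverseʳ p ⟩
  0ℚ            ∎
  where open ≡-Reasoning

-- Dyadic rationals

-- 2^- n is a normalised fraction; its arithmetic is done in ℚᵘ, where it is literally 1 / 2^n.
module _ where
  open import Data.Integer as ℤ using (+_; +<+; -<+)
  import Data.Integer.Properties as ℤₚ

  private
    2^n-1 : ℕ → ℕ
    2^n-1 n = ℕ.pred (2 ℕ.^ n)

    suc[2^n-1]≡2^n : ∀ n → suc (2^n-1 n) ≡ 2 ℕ.^ n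
    suc[2^n-1]≡2^n n = ℕₚ.suc-pred (2 ℕ.^ n) {{ℕₚ.m^n≢0 2 n}}

    2^-ᵘ : ℕ → ℚᵘ.ℚᵘ
    2^-ᵘ n = ℚᵘ.mkℚᵘ (+ 1) (2^n-1 n)

    toℚᵘ-2^- : ∀ n → toℚᵘ (2^- n) ℚᵘ.≃ 2^-ᵘ n
    toℚᵘ-2^- n rewrite /-cong {p₁ = + 1} {q₁ = 2 ℕ.^ n} {p₂ = + 1} {q₂ = suc (2^n-1 n)}
                         {{ℕₚ.m^n≢0 2 n}} refl (sym (suc[2^n-1]≡2^n n))
      = toℚᵘ-fromℚᵘ (2^-ᵘ n)

    2^-ᵘ-half : ∀ n → 2^-ᵘ (suc n) ℚᵘ.+ 2^-ᵘ (suc n) ℚᵘ.≃ 2^-ᵘ n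
    2^-ᵘ-half n = ℚᵘ.*≡* (begin
      (+ 1 ℤ.* + d ℤ.+ + 1 ℤ.* + d) ℤ.* + e   ≡⟨ cong (λ z → (z ℤ.+ z) ℤ.* + e) (ℤₚ.*-identityˡ (+ d)) ⟩
      (+ d ℤ.+ + d) ℤ.* + e                   ≡⟨ cong (ℤ._* + e) (sym (ℤₚ.pos-+ d d)) ⟩
      + (d ℕ.+ d) ℤ.* + e                     ≡⟨ sym (ℤₚ.pos-* (d ℕ.+ d) e) ⟩
      + ((d ℕ.+ d) ℕ.* e)                     ≡⟨ cong +_ d+d*e≡d*d ⟩
      + (d ℕ.* d)                             ≡⟨ sym (ℤₚ.*-identityˡ (+ (d ℕ.* d))) ⟩
      + 1 ℤ.* + (d ℕ.* d)                     ∎)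
      where
      open ≡-Reasoning
      d e : ℕ
      d = suc (2^n-1 (suc n))
      e = suc (2^n-1 n)
      d≡2e : d ≡ 2 ℕ.* e
      d≡2e = trans (suc[2^n-1]≡2^n (suc n)) (cong (2 ℕ.*_) (sym (suc[2^n-1]≡2^n n)))
      d+d*e≡d*d : (d ℕ.+ d) ℕ.* e ≡ d ℕ.* d
      d+d*e≡d*d = begin
        (d ℕ.+ d) ℕ.* e      ≡⟨ ℕₚ.*-distribʳ-+ e d d ⟩
        d ℕ.* e ℕ.+ d ℕ.* e  ≡⟨ ℕₚ.*-distribˡ-+ d e e ⟨
        d ℕ.* (e ℕ.+ e)      ≡⟨ cong (λ z → d ℕ.* (e ℕ.+ z)) (ℕₚ.+-identityʳ e) ⟨
        d ℕ.* (2 ℕ.* e)      ≡⟨ cong (d ℕ.*_) d≡2e ⟨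
        d ℕ.* d              ∎

    n<2^n : ∀ n → n ℕ.< 2 ℕ.^ n
    n<2^n zero = ℕ.s≤s ℕ.z≤n
    n<2^n (suc n) = ℕₚ.+-mono-≤-< (ℕₚ.m^n>0 2 n) (subst (n ℕ.<_) (sym (ℕₚ.+-identityʳ _)) (n<2^n n))

  2^-[1+n]+2^-[1+n]≡2^-n : ∀ n → 2^- (suc n) + 2^- (suc n) ≡ 2^- n
  2^-[1+n]+2^-[1+n]≡2^-n n = toℚᵘ-injective (begin-equality
    toℚᵘ (2^- (suc n) + 2^- (suc n))           ≃⟨ toℚᵘ-homo-+ (2^- (suc n)) (2^- (suc n)) ⟩
    toℚᵘ (2^- (suc n)) ℚᵘ.+ toℚᵘ (2^- (suc n)) ≃⟨ ℚᵘₚ.+-cong (toℚᵘ-2^- (suc n)) (toℚᵘ-2^- (suc n)) ⟩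
    2^-ᵘ (suc n) ℚᵘ.+ 2^-ᵘ (suc n)             ≃⟨ 2^-ᵘ-half n ⟩
    2^-ᵘ n                                     ≃⟨ ℚᵘₚ.≃-sym (toℚᵘ-2^- n) ⟩
    toℚᵘ (2^- n)                               ∎)
    where open ℚᵘₚ.≤-Reasoning

  0<2^-n : ∀ n → 0ℚ < 2^- n
  0<2^-n n = toℚᵘ-cancel-< (ℚᵘₚ.<-respʳ-≃ (ℚᵘₚ.≃-sym (toℚᵘ-2^- n)) (ℚᵘ.*<* (+<+ (ℕ.s≤s ℕ.z≤n))))

  archimedean-2^- : ∀ p → ∃ λ k → p * 2^- k < 1ℚ
  archimedean-2^- p@(mkℚ n d-1 _) = k , toℚᵘ-cancel-< (ℚᵘₚ.<-respˡ-≃ p*2^-k≃ (ℚᵘ.*<* n*1*1<1*D))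
    where
    k D : ℕ
    k = ℤ.∣ n ∣
    D = suc d-1 ℕ.* suc (2^n-1 k)
    p*2^-k≃ : toℚᵘ p ℚᵘ.* 2^-ᵘ k ℚᵘ.≃ toℚᵘ (p * 2^- k)
    p*2^-k≃ = ℚᵘₚ.≃-sym (ℚᵘₚ.≃-trans (toℚᵘ-homo-* p (2^- k))
                                    (ℚᵘₚ.*-cong (ℚᵘₚ.≃-refl {toℚᵘ p}) (toℚᵘ-2^- k)))
    ∣n∣<D : k ℕ.< D
    ∣n∣<D = ℕₚ.<-≤-trans (ℕₚ.<-≤-trans (n<2^n k) (ℕₚ.≤-reflexive (sym (suc[2^n-1]≡2^n k))))
                          (ℕₚ.m≤n*m (suc (2^n-1 k)) (suc d-1))
    i<+D : ∀ i → ℤ.∣ i ∣ ℕ.< D → i ℤ.< + D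
    i<+D (+ _)      ∣i∣<D = +<+ ∣i∣<D
    i<+D ℤ.-[1+ _ ] _     = -<+
    n*1*1<1*D : (n ℤ.* + 1) ℤ.* + 1 ℤ.< + 1 ℤ.* + D
    n*1*1<1*D = subst₂ ℤ._<_ (sym (trans (ℤₚ.*-identityʳ _) (ℤₚ.*-identityʳ n))) (sym (ℤₚ.*-identityˡ (+ D)))
                  (i<+D n ∣n∣<D)

2^-[1+n]≡2^-n*½ : ∀ n → 2^- (suc n) ≡ 2^- n * ½
2^-[1+n]≡2^-n*½ n = begin
  2^- (suc n)                          ≡⟨ solve 1 (λ x → x := (x :+ x) :* con ½) refl (2^- (suc n)) ⟩
  (2^- (suc n) + 2^- (suc n)) * ½      ≡⟨ cong (_* ½) (2^-[1+n]+2^-[1+n]≡2^-n n) ⟩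
  2^- n * ½                            ∎
  where open ≡-Reasoning

2^-[m+n]≡2^-m*2^-n : ∀ m n → 2^- (m ℕ.+ n) ≡ 2^- m * 2^- n
2^-[m+n]≡2^-m*2^-n zero n = sym (*-identityˡ (2^- n))
2^-[m+n]≡2^-m*2^-n (suc m) n = begin
  2^- (suc m ℕ.+ n)         ≡⟨ 2^-[1+n]≡2^-n*½ (m ℕ.+ n) ⟩
  2^- (m ℕ.+ n) * ½         ≡⟨ cong (_* ½) (2^-[m+n]≡2^-m*2^-n m n) ⟩
  (2^- m * 2^- n) * ½       ≡⟨ solve 3 (λ x y h → (x :* y) :* h := (x :* h) :* y) refl (2^- m) (2^- n) ½ ⟩
  (2^- m * ½) * 2^- n       ≡⟨ cong (_* 2^- n) (2^-[1+n]≡2^-n*½ m) ⟨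
  2^- (suc m) * 2^- n       ∎
  where open ≡-Reasoning

2^-[1+n]<2^-n : ∀ n → 2^- (suc n) < 2^- n
2^-[1+n]<2^-n n = subst₂ _<_ (+-identityˡ _) (2^-[1+n]+2^-[1+n]≡2^-n n) (+-monoˡ-< (2^- (suc n)) (0<2^-n (suc n)))

2^-[1+n]≡2^-n-2^-[1+n] : ∀ n → 2^- (suc n) ≡ 2^- n - 2^- (suc n)
2^-[1+n]≡2^-n-2^-[1+n] n = p+q≡r⇒p≡r-q (2^- (suc n)) (2^- (suc n)) (2^-[1+n]+2^-[1+n]≡2^-n n)

2^-‿antimono-≤ : ∀ {m n} → m ℕ.≤ n → 2^- n ≤ 2^- m
2^-‿antimono-≤ m≤n = go (ℕₚ.≤⇒≤′ m≤n)
  where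
  go : ∀ {m n} → m ℕ.≤′ n → 2^- n ≤ 2^- m
  go ℕ.≤′-refl            = ≤-refl
  go (ℕ.≤′-step {n} m≤′n) = ≤-trans (<⇒≤ (2^-[1+n]<2^-n n)) (go m≤′n)

2^-<pos : ∀ {p} → 0ℚ < p → ∃ λ k → 2^- k < p
2^-<pos {p} 0<p = k , subst₂ _<_ p*[p⁻¹*2^-k]≡2^-k (*-identityʳ p) (*-monoʳ-<-pos p p⁻¹*2^-k<1)
  where
  instance
    p>0 : Positive p
    p>0 = positive 0<p
    p≢0 : NonZero p
    p≢0 = pos⇒nonZero p
  k : ℕ
  k = proj₁ (archimedean-2^- (1/ p))
  p⁻¹*2^-k<1 : 1/ p * 2^- k < 1ℚ
  p⁻¹*2^-k<1 = proj₂ (archimedean-2^- (1/ p))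
  p*[p⁻¹*2^-k]≡2^-k : p * (1/ p * 2^- k) ≡ 2^- k
  p*[p⁻¹*2^-k]≡2^-k = trans (sym (*-assoc p (1/ p) (2^- k))) (trans (cong (_* 2^- k) (*-inverseʳ p)) (*-identityˡ (2^- k)))

*2^-<2^- : ∀ p j → ∃ λ k → p * 2^- k < 2^- j
*2^-<2^- p j with archimedean-2^- p
... | k , p*2^-k<1 = k ℕ.+ j , subst₂ _<_ p*2^-k*2^-j≡ (*-identityˡ (2^- j)) (*-monoˡ-<-pos (2^- j) p*2^-k<1)
  where
  instance
    2^-j>0 : Positive (2^- j)
    2^-j>0 = positive (0<2^-n j)
  p*2^-k*2^-j≡ : p * 2^- k * 2^- j ≡ p * 2^- (k ℕ.+ j)
  p*2^-k*2^-j≡ = trans (*-assoc p (2^- k) (2^- j)) (cong (p *_) (sym (2^-[m+n]≡2^-m*2^-n k j)))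

-- Finite unions of intervals

-- (a , b) is the open interval from a to b, empty when b ≤ a.
Interval : Set
Interval = ℚ × ℚ

infixl 7 _∩_
infix 4 _⊑_

_∩_ : Interval → Interval → Interval
(q , r) ∩ (a , b) = (a ⊔ q , b ⊓ r)

leftPart rightPart : Interval → Interval → Interval
leftPart  (q , r) (a , b) = (a , b ⊓ q)
rightPart (q , r) (a , b) = ((a ⊔ q) ⊔ r , b)

_⊑_ : Interval → Interval → Set
(a , b) ⊑ (q , r) = (q ≤ a) × (b ≤ r)

⊑-refl : ∀ {I} → I ⊑ I
⊑-refl = ≤-refl , ≤-refl

⊑-trans : ∀ {I J K} → I ⊑ J → J ⊑ K → I ⊑ K
⊑-trans (c≤a , b≤d) (e≤c , d≤f) = ≤-trans e≤c c≤a , ≤-trans b≤d d≤f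

p∩I⊑p : ∀ p I → p ∩ I ⊑ p
p∩I⊑p (q , r) (a , b) = p≤q⊔p a q , p⊓q≤q b r

I⊑p⇒p∩I≡I : ∀ {p I} → I ⊑ p → p ∩ I ≡ I
I⊑p⇒p∩I≡I (q≤a , b≤r) = cong₂ _,_ (p≥q⇒p⊔q≡p q≤a) (p≤q⇒p⊓q≡p b≤r)

p⊑I⇒p∩I≡p : ∀ {p I} → p ⊑ I → p ∩ I ≡ p
p⊑I⇒p∩I≡p (a≤q , r≤b) = cong₂ _,_ (p≤q⇒p⊔q≡q a≤q) (p≥q⇒p⊓q≡q r≤b)

Additive : (Interval → ℚ) → Set
Additive f = ∀ a b v → f (a , b) ≡ f (a , b ⊓ v) + f (a ⊔ v , b)

module _ {f : Interval → ℚ} (f-additive : Additive f) where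

  additive-empty : ∀ {a b} → b ≤ a → f (a , b) ≡ 0ℚ
  additive-empty {a} {b} b≤a = p≡p+p⇒p≡0 (f (a , b)) (begin
    f (a , b)                          ≡⟨ f-additive a b a ⟩
    f (a , b ⊓ a) + f (a ⊔ a , b)      ≡⟨ cong₂ (λ u w → f (a , u) + f (w , b)) (p≤q⇒p⊓q≡p b≤a) (⊔-idem a) ⟩
    f (a , b) + f (a , b)              ∎)
    where open ≡-Reasoning

  additive-split₃ : ∀ p I → f I ≡ f (leftPart p I) + (f (p ∩ I) + f (rightPart p I))
  additive-split₃ (q , r) (a , b) = trans (f-additive a b q) (cong (f (a , b ⊓ q) +_) (f-additive (a ⊔ q) b r))

  additive-mono : (∀ I → 0ℚ ≤ f I) → ∀ {I J} → I ⊑ J → f I ≤ f J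
  additive-mono f≥0 {I} {J} I⊑J = begin
    f I                                                ≡⟨ cong f (p⊑I⇒p∩I≡p I⊑J) ⟨
    f (I ∩ J)                                          ≤⟨ y≤x+[y+z] (f≥0 (leftPart I J)) (f≥0 (rightPart I J)) ⟩
    f (leftPart I J) + (f (I ∩ J) + f (rightPart I J)) ≡⟨ additive-split₃ I J ⟨
    f J                                                ∎
    where
    open ≤-Reasoning
    y≤x+[y+z] : ∀ {x y z} → 0ℚ ≤ x → 0ℚ ≤ z → y ≤ x + (y + z)
    y≤x+[y+z] {x} {y} {z} 0≤x 0≤z =
      subst (_≤ x + (y + z)) (trans (+-identityˡ _) (+-identityʳ y)) (+-mono-≤ 0≤x (+-monoʳ-≤ y 0≤z))

  additive-∪-ordered : ∀ {q r q′ r′} a b → q ≤ q′ → q′ < r →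
    f (a ⊔ (q ⊓ q′) , b ⊓ (r ⊔ r′)) + f ((a ⊔ q) ⊔ q′ , (b ⊓ r) ⊓ r′) ≡
    f (a ⊔ q , b ⊓ r) + f (a ⊔ q′ , b ⊓ r′)
  additive-∪-ordered {q} {r} {q′} {r′} a b q≤q′ q′<r = begin
    f (a ⊔ (q ⊓ q′) , b ⊓ (r ⊔ r′)) + f ((a ⊔ q) ⊔ q′ , (b ⊓ r) ⊓ r′)
      ≡⟨ cong₂ _+_ (trans (cong (λ z → f (a ⊔ z , b ⊓ (r ⊔ r′))) (p≤q⇒p⊓q≡p q≤q′))
                          (f-additive (a ⊔ q) (b ⊓ (r ⊔ r′)) r))
                   (cong₂ (λ x y → f (x , y)) a⊔q⊔q′≡a⊔q′ (⊓.xy∙z≈xz∙y b r r′)) ⟩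
    (f (a ⊔ q , (b ⊓ (r ⊔ r′)) ⊓ r) + f ((a ⊔ q) ⊔ r , b ⊓ (r ⊔ r′))) + f (a ⊔ q′ , (b ⊓ r′) ⊓ r)
      ≡⟨ cong₂ (λ x y → (f (a ⊔ q , x) + y) + f (a ⊔ q′ , (b ⊓ r′) ⊓ r))
               b⊓[r⊔r′]⊓r≡b⊓r right-parts-agree ⟩
    (f (a ⊔ q , b ⊓ r) + f ((a ⊔ q′) ⊔ r , b ⊓ r′)) + f (a ⊔ q′ , (b ⊓ r′) ⊓ r)
      ≡⟨ +.xy∙z≈x∙zy (f (a ⊔ q , b ⊓ r)) (f ((a ⊔ q′) ⊔ r , b ⊓ r′)) (f (a ⊔ q′ , (b ⊓ r′) ⊓ r)) ⟩
    f (a ⊔ q , b ⊓ r) + (f (a ⊔ q′ , (b ⊓ r′) ⊓ r) + f ((a ⊔ q′) ⊔ r , b ⊓ r′))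
      ≡⟨ cong (f (a ⊔ q , b ⊓ r) +_) (f-additive (a ⊔ q′) (b ⊓ r′) r) ⟨
    f (a ⊔ q , b ⊓ r) + f (a ⊔ q′ , b ⊓ r′) ∎
    where
    open ≡-Reasoning
    q≤r : q ≤ r
    q≤r = ≤-trans q≤q′ (<⇒≤ q′<r)
    a⊔q⊔q′≡a⊔q′ : (a ⊔ q) ⊔ q′ ≡ a ⊔ q′
    a⊔q⊔q′≡a⊔q′ = trans (⊔-assoc a q q′) (cong (a ⊔_) (p≤q⇒p⊔q≡q q≤q′))
    b⊓[r⊔r′]⊓r≡b⊓r : (b ⊓ (r ⊔ r′)) ⊓ r ≡ b ⊓ r
    b⊓[r⊔r′]⊓r≡b⊓r =
      trans (⊓-assoc b (r ⊔ r′) r) (cong (b ⊓_) (trans (⊓-comm (r ⊔ r′) r) (⊓-absorbs-⊔ r r′)))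
    a⊔q⊔r≡a⊔q′⊔r : (a ⊔ q) ⊔ r ≡ (a ⊔ q′) ⊔ r
    a⊔q⊔r≡a⊔q′⊔r = begin
      (a ⊔ q) ⊔ r  ≡⟨ ⊔-assoc a q r ⟩
      a ⊔ (q ⊔ r)  ≡⟨ cong (a ⊔_) (p≤q⇒p⊔q≡q q≤r) ⟩
      a ⊔ r        ≡⟨ cong (a ⊔_) (p≤q⇒p⊔q≡q (<⇒≤ q′<r)) ⟨
      a ⊔ (q′ ⊔ r) ≡⟨ ⊔-assoc a q′ r ⟨
      (a ⊔ q′) ⊔ r ∎
    right-parts-agree : f ((a ⊔ q) ⊔ r , b ⊓ (r ⊔ r′)) ≡ f ((a ⊔ q′) ⊔ r , b ⊓ r′)
    right-parts-agree with ≤-total r r′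
    ... | inj₁ r≤r′ = cong₂ (λ x y → f (x , b ⊓ y)) a⊔q⊔r≡a⊔q′⊔r (p≤q⇒p⊔q≡q r≤r′)
    ... | inj₂ r′≤r = trans (additive-empty (≤-trans (≤-reflexive (cong (b ⊓_) (p≥q⇒p⊔q≡p r′≤r)))
                                                     (≤-trans (p⊓q≤q b r) (p≤q⊔p (a ⊔ q) r))))
                            (sym (additive-empty (≤-trans (p⊓q≤q b r′) (≤-trans r′≤r (p≤q⊔p (a ⊔ q′) r)))))

  additive-∪ : ∀ {q r q′ r′} → q′ < r → q < r′ → ∀ I →
    f ((q ⊓ q′ , r ⊔ r′) ∩ I) + f ((q′ , r′) ∩ ((q , r) ∩ I)) ≡ f ((q , r) ∩ I) + f ((q′ , r′) ∩ I)
  additive-∪ {q} {r} {q′} {r′} q′<r q<r′ (a , b) with ≤-total q q′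
  ... | inj₁ q≤q′ = additive-∪-ordered a b q≤q′ q′<r
  ... | inj₂ q′≤q = begin
    f (a ⊔ (q ⊓ q′) , b ⊓ (r ⊔ r′)) + f ((a ⊔ q) ⊔ q′ , (b ⊓ r) ⊓ r′)
      ≡⟨ cong₂ _+_ (cong₂ (λ x y → f (a ⊔ x , b ⊓ y)) (⊓-comm q q′) (⊔-comm r r′))
                   (cong₂ (λ x y → f (x , y)) (⊔.xy∙z≈xz∙y a q q′) (⊓.xy∙z≈xz∙y b r r′)) ⟩
    f (a ⊔ (q′ ⊓ q) , b ⊓ (r′ ⊔ r)) + f ((a ⊔ q′) ⊔ q , (b ⊓ r′) ⊓ r)
      ≡⟨ additive-∪-ordered a b q′≤q q<r′ ⟩
    f (a ⊔ q′ , b ⊓ r′) + f (a ⊔ q , b ⊓ r)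
      ≡⟨ +-comm (f (a ⊔ q′ , b ⊓ r′)) (f (a ⊔ q , b ⊓ r)) ⟩
    f (a ⊔ q , b ⊓ r) + f (a ⊔ q′ , b ⊓ r′) ∎
    where open ≡-Reasoning

additive-− : ∀ {f g} → Additive f → Additive g → Additive (λ I → f I - g I)
additive-− {f} {g} f-additive g-additive a b v rewrite f-additive a b v | g-additive a b v =
  solve 4 (λ x y z w → (x :+ y) :- (z :+ w) := (x :- z) :+ (y :- w)) refl
    (f (a , b ⊓ v)) (f (a ⊔ v , b)) (g (a , b ⊓ v)) (g (a ⊔ v , b))

opaque
  len : Interval → ℚ
  len (a , b) = 0ℚ ⊔ (b - a)

  0≤len : ∀ I → 0ℚ ≤ len I
  0≤len (a , b) = p≤p⊔q 0ℚ (b - a)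

  len-empty : ∀ {a b} → b ≤ a → len (a , b) ≡ 0ℚ
  len-empty b≤a = p≥q⇒p⊔q≡p (p≤q⇒p-q≤0 b≤a)

  len-nonempty : ∀ {a b} → a ≤ b → len (a , b) ≡ b - a
  len-nonempty a≤b = p≤q⇒p⊔q≡q (p≤q⇒0≤q-p a≤b)

  len-additive : Additive len
  len-additive a b v with ≤-total v a
  ... | inj₁ v≤a rewrite p≥q⇒p⊔q≡p v≤a | len-empty {a} {b ⊓ v} (≤-trans (p⊓q≤q b v) v≤a) =
    sym (+-identityˡ _)
  ... | inj₂ a≤v rewrite p≤q⇒p⊔q≡q a≤v with ≤-total b v
  ...   | inj₁ b≤v rewrite p≤q⇒p⊓q≡p b≤v | len-empty {v} {b} b≤v = sym (+-identityʳ _)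
  ...   | inj₂ v≤b rewrite p≥q⇒p⊓q≡q v≤b | len-nonempty a≤v | len-nonempty v≤b | len-nonempty (≤-trans a≤v v≤b) =
    solve 3 (λ a b v → b :- a := (v :- a) :+ (b :- v)) refl a b v

-- measure L I is the length of I ∩ ⋃ L, computed by inclusion–exclusion:
-- |I ∩ (p ∪ ⋃ L)| = |p ∩ I| + |I ∩ ⋃ L| − |(p ∩ I) ∩ ⋃ L|.
measure : List Interval → Interval → ℚ
measure []      I = 0ℚ
measure (p ∷ L) I = (len (p ∩ I) + measure L I) - measure L (p ∩ I)

measure-additive : ∀ L → Additive (measure L)
measure-additive []            a b v = sym (+-identityʳ 0ℚ)
measure-additive ((q , r) ∷ L) a b v
  rewrite len-additive (a ⊔ q) (b ⊓ r) v | measure-additive L a b v | measure-additive L (a ⊔ q) (b ⊓ r) v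
        | ⊓.xy∙z≈xz∙y b r v | ⊔.xy∙z≈xz∙y a q v =
  solve 6 (λ x₁ x₂ y₁ y₂ z₁ z₂ → ((x₁ :+ x₂) :+ (y₁ :+ y₂)) :- (z₁ :+ z₂)
                                 := ((x₁ :+ y₁) :- z₁) :+ ((x₂ :+ y₂) :- z₂)) refl
    (len (a ⊔ q , b ⊓ v ⊓ r)) (len (a ⊔ v ⊔ q , b ⊓ r)) (measure L (a , b ⊓ v)) (measure L (a ⊔ v , b))
    (measure L (a ⊔ q , b ⊓ v ⊓ r)) (measure L (a ⊔ v ⊔ q , b ⊓ r))

measure-∷ : ∀ p L I → measure (p ∷ L) I ≡ len (p ∩ I) + (measure L (leftPart p I) + measure L (rightPart p I))
measure-∷ p L I rewrite additive-split₃ (measure-additive L) p I =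
  solve 4 (λ x l c r → (x :+ (l :+ (c :+ r))) :- c := x :+ (l :+ r)) refl
    (len (p ∩ I)) (measure L (leftPart p I)) (measure L (p ∩ I)) (measure L (rightPart p I))

0≤measure : ∀ L I → 0ℚ ≤ measure L I
0≤measure []      I = ≤-refl
0≤measure (p ∷ L) I rewrite measure-∷ p L I =
  +-mono-≤ (0≤len (p ∩ I)) (+-mono-≤ (0≤measure L (leftPart p I)) (0≤measure L (rightPart p I)))

measure≤len : ∀ L I → measure L I ≤ len I
measure≤len []      I = 0≤len I
measure≤len (p ∷ L) I = begin
  measure (p ∷ L) I                                              ≡⟨ measure-∷ p L I ⟩
  len (p ∩ I) + (measure L (leftPart p I) + measure L (rightPart p I))
    ≤⟨ +-monoʳ-≤ (len (p ∩ I)) (+-mono-≤ (measure≤len L (leftPart p I)) (measure≤len L (rightPart p I))) ⟩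
  len (p ∩ I) + (len (leftPart p I) + len (rightPart p I))
    ≡⟨ +.x∙yz≈y∙xz (len (p ∩ I)) (len (leftPart p I)) (len (rightPart p I)) ⟩
  len (leftPart p I) + (len (p ∩ I) + len (rightPart p I))      ≡⟨ additive-split₃ len-additive p I ⟨
  len I                                                          ∎
  where open ≤-Reasoning

measure-empty : ∀ L {a b} → b ≤ a → measure L (a , b) ≡ 0ℚ
measure-empty L = additive-empty (measure-additive L)

measure-∷-≥ : ∀ p L I → measure L I ≤ measure (p ∷ L) I
measure-∷-≥ p L I = begin
  measure L I                                           ≡⟨ +-identityʳ _ ⟨
  measure L I + 0ℚ
    ≤⟨ +-monoʳ-≤ (measure L I) (p≤q⇒0≤q-p (measure≤len L (p ∩ I))) ⟩
  measure L I + (len (p ∩ I) - measure L (p ∩ I))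
    ≡⟨ solve 3 (λ c x y → x :+ (c :- y) := (c :+ x) :- y) refl (len (p ∩ I)) (measure L I) (measure L (p ∩ I)) ⟩
  measure (p ∷ L) I                                     ∎
  where open ≤-Reasoning

measure-covered : ∀ L I → Any (I ⊑_) L → measure L I ≡ len I
measure-covered (p ∷ L) I (here I⊑p) = begin
  (len (p ∩ I) + measure L I) - measure L (p ∩ I)
    ≡⟨ cong (λ J → (len J + measure L I) - measure L J) (I⊑p⇒p∩I≡I I⊑p) ⟩
  (len I + measure L I) - measure L I             ≡⟨ solve 2 (λ x y → (x :+ y) :- y := x) refl (len I) (measure L I) ⟩
  len I                                           ∎
  where open ≡-Reasoning
measure-covered (p ∷ L) I (there I⊑L) = ≤-antisym (measure≤len (p ∷ L) I)
  (subst (_≤ measure (p ∷ L) I) (measure-covered L I I⊑L) (measure-∷-≥ p L I))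

Refines : List Interval → List Interval → Set
Refines L′ L = All (λ p′ → Any (p′ ⊑_) L) L′

measure-mono : ∀ {L′ L} → Refines L′ L → ∀ I → measure L′ I ≤ measure L I
measure-mono {[]}     {L} []                I = 0≤measure L I
measure-mono {p ∷ L′} {L} (p⊑L ∷ L′≼L) I = begin
  measure (p ∷ L′) I                                                     ≡⟨ measure-∷ p L′ I ⟩
  len (p ∩ I) + (measure L′ (leftPart p I) + measure L′ (rightPart p I))
    ≤⟨ +-mono-≤ (≤-reflexive (sym (measure-covered L (p ∩ I) (Any.map (⊑-trans (p∩I⊑p p I)) p⊑L))))
                (+-mono-≤ (measure-mono L′≼L (leftPart p I)) (measure-mono L′≼L (rightPart p I))) ⟩
  measure L (p ∩ I) + (measure L (leftPart p I) + measure L (rightPart p I))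
    ≡⟨ +.x∙yz≈y∙xz (measure L (p ∩ I)) (measure L (leftPart p I)) (measure L (rightPart p I)) ⟩
  measure L (leftPart p I) + (measure L (p ∩ I) + measure L (rightPart p I)) ≡⟨ additive-split₃ (measure-additive L) p I ⟨
  measure L I                                                            ∎
  where open ≤-Reasoning

measure-merge : ∀ {q r q′ r′} → q′ < r → q < r′ → ∀ L I →
  measure ((q ⊓ q′ , r ⊔ r′) ∷ L) I ≡ measure ((q , r) ∷ (q′ , r′) ∷ L) I
measure-merge {q} {r} {q′} {r′} q′<r q<r′ L I =
  trans (cong₂ (λ x y → (x + measure L I) - y)
           (p+q≡r⇒p≡r-q (len (p∪p′ ∩ I)) (len (p′ ∩ (p ∩ I))) (additive-∪ len-additive q′<r q<r′ I))
           (p+q≡r⇒p≡r-q (measure L (p∪p′ ∩ I)) (measure L (p′ ∩ (p ∩ I)))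
                         (additive-∪ (measure-additive L) q′<r q<r′ I)))
        (solve 7 (λ l l′ l″ m m′ m″ x → (((l :+ l′) :- l″) :+ x) :- ((m :+ m′) :- m″)
                                        := (l :+ ((l′ :+ x) :- m′)) :- ((l″ :+ m) :- m″)) refl
           (len (p ∩ I)) (len (p′ ∩ I)) (len (p′ ∩ (p ∩ I)))
           (measure L (p ∩ I)) (measure L (p′ ∩ I)) (measure L (p′ ∩ (p ∩ I))) (measure L I))
  where
  p p′ p∪p′ : Interval
  p  = (q , r)
  p′ = (q′ , r′)
  p∪p′ = (q ⊓ q′ , r ⊔ r′)

measure-swap : ∀ p p′ L I → measure (p ∷ p′ ∷ L) I ≡ measure (p′ ∷ p ∷ L) I
measure-swap p@(q , r) p′@(q′ , r′) L I@(a , b) =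
  trans (cong (λ J → (len (p ∩ I) + ((len (p′ ∩ I) + measure L I) - measure L (p′ ∩ I)))
                     - ((len J + measure L (p ∩ I)) - measure L J))
              (cong₂ _,_ (⊔.xy∙z≈xz∙y a q q′) (⊓.xy∙z≈xz∙y b r r′)))
        (solve 7 (λ l l′ l″ m m′ m″ x → (l :+ ((l′ :+ x) :- m′)) :- ((l″ :+ m) :- m″)
                                        := (l′ :+ ((l :+ x) :- m)) :- ((l″ :+ m′) :- m″)) refl
           (len (p ∩ I)) (len (p′ ∩ I)) (len (p ∩ (p′ ∩ I)))
           (measure L (p ∩ I)) (measure L (p′ ∩ I)) (measure L (p ∩ (p′ ∩ I))) (measure L I))

measure-insertI : ∀ p L I → measure (insertI p L) I ≡ measure (p ∷ L) I
measure-insertI (q , r) [] I = refl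
measure-insertI (q , r) ((q′ , r′) ∷ L) I with r ≤? q′
... | yes _ = refl
... | no r≰q′ with r′ ≤? q
...   | yes _ = trans (cong₂ (λ x y → (len ((q′ , r′) ∩ I) + x) - y)
                             (measure-insertI (q , r) L I) (measure-insertI (q , r) L ((q′ , r′) ∩ I)))
                      (measure-swap (q′ , r′) (q , r) L I)
...   | no r′≰q = trans (measure-insertI (q ⊓ q′ , r ⊔ r′) L I) (measure-merge (≰⇒> r≰q′) (≰⇒> r′≰q) L I)

measure-normalise : ∀ L I → measure (normalise L) I ≡ measure L I
measure-normalise [] I = refl
measure-normalise ((q , r) ∷ L) I@(a , b) with r ≤? q
... | yes r≤q = sym (begin
  (len ((q , r) ∩ I) + measure L I) - measure L ((q , r) ∩ I)
    ≡⟨ cong₂ (λ x y → (x + measure L I) - y) (len-empty p∩I-empty) (measure-empty L p∩I-empty) ⟩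
  (0ℚ + measure L I) - 0ℚ  ≡⟨ trans (+-identityʳ _) (+-identityˡ _) ⟩
  measure L I              ≡⟨ measure-normalise L I ⟨
  measure (normalise L) I  ∎)
  where
  open ≡-Reasoning
  p∩I-empty : b ⊓ r ≤ a ⊔ q
  p∩I-empty = ≤-trans (p⊓q≤q b r) (≤-trans r≤q (p≤q⊔p a q))
... | no _ = trans (measure-insertI (q , r) (normalise L) I)
                   (cong₂ (λ x y → (len ((q , r) ∩ I) + x) - y) (measure-normalise L I) (measure-normalise L ((q , r) ∩ I)))

-- Normal forms

Separated : List Interval → Set
Separated []            = ⊤
Separated ((q , r) ∷ L) = (q < r) × All ((r ≤_) ∘ proj₁) L × Separated L

insertI-right-of : ∀ {r₀} p L → r₀ ≤ proj₁ p → All ((r₀ ≤_) ∘ proj₁) L →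
                   All ((r₀ ≤_) ∘ proj₁) (insertI p L)
insertI-right-of (q , r) [] r₀≤q _ = r₀≤q ∷ []
insertI-right-of (q , r) ((q′ , r′) ∷ L) r₀≤q (r₀≤q′ ∷ r₀≤L) with r ≤? q′
... | yes _ = r₀≤q ∷ r₀≤q′ ∷ r₀≤L
... | no _ with r′ ≤? q
...   | yes _ = r₀≤q′ ∷ insertI-right-of (q , r) L r₀≤q r₀≤L
...   | no _  = insertI-right-of (q ⊓ q′ , r ⊔ r′) L (⊓-glb r₀≤q r₀≤q′) r₀≤L

insertI-separated : ∀ p L → proj₁ p < proj₂ p → Separated L → Separated (insertI p L)
insertI-separated (q , r) [] q<r _ = q<r , [] , tt
insertI-separated (q , r) ((q′ , r′) ∷ L) q<r sep@(q′<r′ , r′≤L , L-sep) with r ≤? q′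
... | yes r≤q′ = q<r , r≤q′ ∷ All.map (≤-trans (≤-trans r≤q′ (<⇒≤ q′<r′))) r′≤L , sep
... | no _ with r′ ≤? q
...   | yes r′≤q = q′<r′ , insertI-right-of (q , r) L r′≤q r′≤L , insertI-separated (q , r) L q<r L-sep
...   | no _     =
  insertI-separated (q ⊓ q′ , r ⊔ r′) L (≤-<-trans (p⊓q≤p q q′) (<-≤-trans q<r (p≤p⊔q r r′))) L-sep

normalise-separated : ∀ L → Separated (normalise L)
normalise-separated [] = tt
normalise-separated ((q , r) ∷ L) with r ≤? q
... | yes _  = normalise-separated L
... | no r≰q = insertI-separated (q , r) (normalise L) (≰⇒> r≰q) (normalise-separated L)

insertI-within : ∀ {J} p L → p ⊑ J → All (_⊑ J) L → All (_⊑ J) (insertI p L)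
insertI-within (q , r) [] p⊑J _ = p⊑J ∷ []
insertI-within (q , r) ((q′ , r′) ∷ L) p⊑J (p′⊑J ∷ L⊑J) with r ≤? q′
... | yes _ = p⊑J ∷ p′⊑J ∷ L⊑J
... | no _ with r′ ≤? q
...   | yes _ = p′⊑J ∷ insertI-within (q , r) L p⊑J L⊑J
...   | no _  =
  insertI-within (q ⊓ q′ , r ⊔ r′) L (⊓-glb (proj₁ p⊑J) (proj₁ p′⊑J) , ⊔-lub (proj₂ p⊑J) (proj₂ p′⊑J)) L⊑J

normalise-within : ∀ {J} L → All (_⊑ J) L → All (_⊑ J) (normalise L)
normalise-within [] _ = []
normalise-within ((q , r) ∷ L) (p⊑J ∷ L⊑J) with r ≤? q
... | yes _ = normalise-within L L⊑J
... | no _  = insertI-within (q , r) (normalise L) p⊑J (normalise-within L L⊑J)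

measure-left-of : ∀ {r₀} L → All ((r₀ ≤_) ∘ proj₁) L → ∀ a {b} → b ≤ r₀ → measure L (a , b) ≡ 0ℚ
measure-left-of []              _               a b≤r₀ = refl
measure-left-of {r₀} ((q′ , r′) ∷ L) (r₀≤q′ ∷ r₀≤L) a {b} b≤r₀ =
  trans (cong₂ (λ x y → (x + y) - measure L (a ⊔ q′ , b ⊓ r′))
               (len-empty p′∩I-empty) (measure-left-of L r₀≤L a b≤r₀))
        (cong (λ x → (0ℚ + 0ℚ) - x) (measure-empty L p′∩I-empty))
  where
  p′∩I-empty : b ⊓ r′ ≤ a ⊔ q′
  p′∩I-empty = ≤-trans (p⊓q≤p b r′) (≤-trans b≤r₀ (≤-trans r₀≤q′ (p≤q⊔p a q′)))

totalLength≡measure : ∀ {J} L → Separated L → All (_⊑ J) L → totalLength L ≡ measure L J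
totalLength≡measure [] _ _ = refl
totalLength≡measure {J} ((q , r) ∷ L) (q<r , r≤L , L-sep) (p⊑J ∷ L⊑J) = sym (begin
  (len ((q , r) ∩ J) + measure L J) - measure L ((q , r) ∩ J)
    ≡⟨ cong (λ K → (len K + measure L J) - measure L K) (p⊑I⇒p∩I≡p p⊑J) ⟩
  (len (q , r) + measure L J) - measure L (q , r)
    ≡⟨ cong₂ (λ x y → (x + measure L J) - y) (len-nonempty (<⇒≤ q<r)) (measure-left-of L r≤L q ≤-refl) ⟩
  ((r - q) + measure L J) - 0ℚ
    ≡⟨ +-identityʳ _ ⟩
  (r - q) + measure L J
    ≡⟨ cong ((r - q) +_) (totalLength≡measure L L-sep L⊑J) ⟨
  (r - q) + totalLength L ∎)
  where open ≡-Reasoning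

-- μ-fin E a is μᴸ (map (pair E) a) by definition.
μᴸ : List Interval → ℚ
μᴸ L = totalLength (normalise L)

μᴸ≡measure : ∀ {J} L → All (_⊑ J) L → μᴸ L ≡ measure L J
μᴸ≡measure L L⊑J = trans (totalLength≡measure (normalise L) (normalise-separated L) (normalise-within L L⊑J))
                         (measure-normalise L _)

hull : List Interval → Interval → Interval
hull []            J       = J
hull ((q , r) ∷ L) (a , b) = hull L (a ⊓ q , b ⊔ r)

⊑-hull : ∀ {K} L J → K ⊑ J → K ⊑ hull L J
⊑-hull []            J       K⊑J            = K⊑J
⊑-hull ((q , r) ∷ L) (a , b) (a≤c , d≤b) =
  ⊑-hull L (a ⊓ q , b ⊔ r) (≤-trans (p⊓q≤p a q) a≤c , ≤-trans d≤b (p≤p⊔q b r))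

All⊑hull : ∀ L J → All (_⊑ hull L J) L
All⊑hull []            J       = []
All⊑hull ((q , r) ∷ L) (a , b) = ⊑-hull L (a ⊓ q , b ⊔ r) (p⊓q≤q a q , p≤q⊔p b r) ∷ All⊑hull L (a ⊓ q , b ⊔ r)

measure-increment-mono : ∀ {L L′} → Refines L L′ → ∀ {I J} → I ⊑ J →
  measure L′ I - measure L I ≤ measure L′ J - measure L J
measure-increment-mono {L} {L′} L≼L′ =
  additive-mono (additive-− (measure-additive L′) (measure-additive L)) (λ I → p≤q⇒0≤q-p (measure-mono L≼L′ I))

-- Uncovered parts

uncovered : List Interval → Interval → ℚ
uncovered A J = len J - measure A J

uncovered-additive : ∀ A → Additive (uncovered A)
uncovered-additive A = additive-− len-additive (measure-additive A)

uncovered≤len : ∀ A J → uncovered A J ≤ len J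
uncovered≤len A J = subst (uncovered A J ≤_) (+-identityʳ (len J)) (-‿mono-≤ (≤-refl {len J}) (0≤measure A J))

uncovered-covered : ∀ A J → Any (J ⊑_) A → uncovered A J ≡ 0ℚ
uncovered-covered A J J⊑A = trans (cong (λ x → len J - x) (measure-covered A J J⊑A)) (+-inverseʳ (len J))

sumℚ : List ℚ → ℚ
sumℚ = foldr _+_ 0ℚ

measure-++-subadditive : ∀ A B I → measure (B ++ A) I ≤ measure A I + sumℚ (map (λ p → uncovered A (p ∩ I)) B)
measure-++-subadditive A []      I = ≤-reflexive (sym (+-identityʳ (measure A I)))
measure-++-subadditive A (p ∷ B) I = begin
  (len (p ∩ I) + measure (B ++ A) I) - measure (B ++ A) (p ∩ I)
    ≤⟨ -‿mono-≤ (+-monoʳ-≤ (len (p ∩ I)) (measure-++-subadditive A B I)) (measure-mono (Refines-++ʳ B) (p ∩ I)) ⟩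
  (len (p ∩ I) + (measure A I + rest)) - measure A (p ∩ I)
    ≡⟨ solve 4 (λ l x y z → (l :+ (x :+ y)) :- z := x :+ ((l :- z) :+ y)) refl
         (len (p ∩ I)) (measure A I) rest (measure A (p ∩ I)) ⟩
  measure A I + (uncovered A (p ∩ I) + rest) ∎
  where
  open ≤-Reasoning
  rest : ℚ
  rest = sumℚ (map (λ p → uncovered A (p ∩ I)) B)
  Refines-++ʳ : ∀ B → Refines A (B ++ A)
  Refines-++ʳ []      = All.tabulate (Any.map (λ { refl → ⊑-refl }))
  Refines-++ʳ (_ ∷ B) = All.map there (Refines-++ʳ B)

pigeonhole : ∀ {X : Set} (f : X → ℚ) t xs → sumℚ (replicate (length xs) t) < sumℚ (map f xs) → Any (λ x → t < f x) xs
pigeonhole f t []       Σ<Σ = ⊥-elim (<-irrefl refl Σ<Σ)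
pigeonhole f t (x ∷ xs) Σ<Σ with t <? f x
... | yes t<fx = here t<fx
... | no  t≮fx with sumℚ (replicate (length xs) t) <? sumℚ (map f xs)
...   | yes Σ<Σ′ = there (pigeonhole f t xs Σ<Σ′)
...   | no  Σ≮Σ′ = ⊥-elim (<-irrefl refl (<-≤-trans Σ<Σ (+-mono-≤ (≮⇒≥ t≮fx) (≮⇒≥ Σ≮Σ′))))

sumℚ-replicate-2^- : ∀ n k → sumℚ (replicate n (2^- (k ℕ.+ n))) < 2^- k
sumℚ-replicate-2^- zero    k = 0<2^-n k
sumℚ-replicate-2^- (suc n) k = begin-strict
  2^- (k ℕ.+ suc n) + sumℚ (replicate n (2^- (k ℕ.+ suc n)))
    ≡⟨ cong (λ m → 2^- m + sumℚ (replicate n (2^- m))) (ℕₚ.+-suc k n) ⟩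
  2^- (suc k ℕ.+ n) + sumℚ (replicate n (2^- (suc k ℕ.+ n)))
    <⟨ +-mono-≤-< (2^-‿antimono-≤ (ℕₚ.m≤m+n (suc k) n)) (sumℚ-replicate-2^- n (suc k)) ⟩
  2^- (suc k) + 2^- (suc k)
    ≡⟨ 2^-[1+n]+2^-[1+n]≡2^-n k ⟩
  2^- k ∎
  where open ≤-Reasoning

len≤ : ∀ {a b η} → 0ℚ ≤ η → b - a ≤ η → len (a , b) ≤ η
len≤ {a} {b} 0≤η b-a≤η with ≤-total a b
... | inj₁ a≤b = subst (_≤ _) (sym (len-nonempty a≤b)) b-a≤η
... | inj₂ b≤a = subst (_≤ _) (sym (len-empty b≤a)) 0≤η

uncovered-shrink : ∀ A c d {η} → 0ℚ ≤ η → uncovered A (c , d) ≤ uncovered A (c + η , d - η) + (η + η)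
uncovered-shrink A c d {η} 0≤η = begin
  f (c , d)                                                    ≡⟨ uncovered-additive A c d (c + η) ⟩
  f (c , d ⊓ (c + η)) + f (c ⊔ (c + η) , d)
    ≡⟨ cong (λ z → f (c , d ⊓ (c + η)) + f (z , d)) (p≤q⇒p⊔q≡q (p≤p+q c 0≤η)) ⟩
  f (c , d ⊓ (c + η)) + f (c + η , d)
    ≡⟨ cong (f (c , d ⊓ (c + η)) +_) (uncovered-additive A (c + η) d (d - η)) ⟩
  f (c , d ⊓ (c + η)) + (f (c + η , d ⊓ (d - η)) + f ((c + η) ⊔ (d - η) , d))
    ≡⟨ cong (λ z → f (c , d ⊓ (c + η)) + (f (c + η , z) + f ((c + η) ⊔ (d - η) , d)))
            (p≥q⇒p⊓q≡q (p-q≤p d 0≤η)) ⟩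
  f (c , d ⊓ (c + η)) + (f (c + η , d - η) + f ((c + η) ⊔ (d - η) , d))
    ≤⟨ +-mono-≤ (≤-trans (uncovered≤len A _) (len≤ 0≤η left-strip))
                (+-monoʳ-≤ (f (c + η , d - η)) (≤-trans (uncovered≤len A _) (len≤ 0≤η right-strip))) ⟩
  η + (f (c + η , d - η) + η)                                  ≡⟨ +.x∙yz≈y∙zx η (f (c + η , d - η)) η ⟩
  f (c + η , d - η) + (η + η)                                  ∎
  where
  open ≤-Reasoning
  f : Interval → ℚ
  f = uncovered A
  left-strip : d ⊓ (c + η) - c ≤ η
  left-strip = p≤q+r⇒p-q≤r (p⊓q≤q d (c + η))
  right-strip : d - ((c + η) ⊔ (d - η)) ≤ η
  right-strip = subst (d - ((c + η) ⊔ (d - η)) ≤_) (p-[p-q]≡q d η)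
                      (-‿mono-≤ (≤-refl {d}) (p≤q⊔p (c + η) (d - η)))

uncovered-somewhere : ∀ A B t → sumℚ (replicate (length B) t) < μᴸ B - μᴸ A → ∃ λ p → p ∈ B × t < uncovered A p
uncovered-somewhere A B t t-sum<gain =
  let p , p∈B , t<uncovered = find (pigeonhole (λ p → uncovered A (p ∩ Big)) t B t-sum<uncovered)
  in  p , p∈B , subst (λ J → t < uncovered A J) (p⊑I⇒p∩I≡p (All.lookup B⊑Big p∈B)) t<uncovered
  where
  Big : Interval
  Big = hull (B ++ A) (0ℚ , 0ℚ)
  B⊑Big : All (_⊑ Big) B
  B⊑Big = All.++⁻ˡ B (All⊑hull (B ++ A) (0ℚ , 0ℚ))
  A⊑Big : All (_⊑ Big) A
  A⊑Big = All.++⁻ʳ B (All⊑hull (B ++ A) (0ℚ , 0ℚ))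
  B≼B++A : Refines B (B ++ A)
  B≼B++A = All.tabulate (λ p∈B → Any.map (λ { refl → ⊑-refl }) (Any.++⁺ˡ p∈B))
  t-sum<uncovered : sumℚ (replicate (length B) t) < sumℚ (map (λ p → uncovered A (p ∩ Big)) B)
  t-sum<uncovered = <-≤-trans t-sum<gain (begin
    μᴸ B - μᴸ A                           ≡⟨ cong₂ _-_ (μᴸ≡measure B B⊑Big) (μᴸ≡measure A A⊑Big) ⟩
    measure B Big - measure A Big         ≤⟨ -‿mono-≤ (measure-mono B≼B++A Big) (≤-refl {measure A Big}) ⟩
    measure (B ++ A) Big - measure A Big  ≤⟨ p≤q+r⇒p-q≤r (measure-++-subadditive A B Big) ⟩
    sumℚ (map (λ p → uncovered A (p ∩ Big)) B) ∎)
    where open ≤-Reasoning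

_⋐_ : Interval → Interval → Set
(a , b) ⋐ (q , r) = (q < a) × (b < r)

uncovered-somewhere-inside : ∀ A B r → sumℚ (replicate (length B) (2^- r)) < μᴸ B - μᴸ A →
                             ∃ λ p → p ∈ B × ∃ λ J → J ⋐ p × 2^- suc r ≤ uncovered A J
uncovered-somewhere-inside A B r t-sum<gain =
  let (c , d) , p∈B , 2^-r<uncovered = uncovered-somewhere A B (2^- r) t-sum<gain
  in  (c , d) , p∈B , (c + η , d - η) , (p<p+q c 0<η , p-q<p d 0<η) , (begin
    2^- suc r                              ≡⟨ 2^-[1+n]≡2^-n-2^-[1+n] r ⟩
    2^- r - 2^- suc r                      ≡⟨ cong (λ z → 2^- r - z) (2^-[1+n]+2^-[1+n]≡2^-n (suc r)) ⟨
    2^- r - (η + η)                        ≤⟨ -‿mono-≤ (<⇒≤ 2^-r<uncovered) (≤-refl {η + η}) ⟩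
    uncovered A (c , d) - (η + η)          ≤⟨ p≤q+r⇒p-r≤q (uncovered-shrink A c d (<⇒≤ 0<η)) ⟩
    uncovered A (c + η , d - η)            ∎)
  where
  open ≤-Reasoning
  η : ℚ
  η = 2^- (2 ℕ.+ r)
  0<η : 0ℚ < η
  0<η = 0<2^-n (2 ℕ.+ r)

additive-half : ∀ {f} → Additive f → ∀ {u w v e} → u ≤ w → w ≤ v → e + e ≤ f (u , v) →
                e ≤ f (u , w) ⊎ e ≤ f (w , v)
additive-half {f} f-additive {u} {w} {v} {e} u≤w w≤v e+e≤f[u,v] with e ≤? f (u , w)
... | yes e≤f[u,w] = inj₁ e≤f[u,w]
... | no  e≰f[u,w] = inj₂ (≮⇒≥ λ f[w,v]<e → <-irrefl refl (≤-<-trans e+e≤f[u,v] (begin-strict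
  f (u , v)                         ≡⟨ f-additive u v w ⟩
  f (u , v ⊓ w) + f (u ⊔ w , v)     ≡⟨ cong₂ (λ x y → f (u , x) + f (y , v)) (p≥q⇒p⊓q≡q w≤v) (p≤q⇒p⊔q≡q u≤w) ⟩
  f (u , w) + f (w , v)             <⟨ +-mono-< (≰⇒> e≰f[u,w]) f[w,v]<e ⟩
  e + e                             ∎)))
  where open ≤-Reasoning

uncovered-refines : ∀ {A A′} → Refines A A′ → ∀ I → uncovered A I - (μᴸ A′ - μᴸ A) ≤ uncovered A′ I
uncovered-refines {A} {A′} A≼A′ I = begin
  (len I - measure A I) - (μᴸ A′ - μᴸ A)
    ≡⟨ cong₂ (λ x y → (len I - measure A I) - (x - y))
             (μᴸ≡measure A′ (All.++⁻ʳ A A++A′⊑Big)) (μᴸ≡measure A (All.++⁻ˡ A A++A′⊑Big)) ⟩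
  (len I - measure A I) - (measure A′ Big - measure A Big)
    ≤⟨ -‿mono-≤ (≤-refl {len I - measure A I}) (measure-increment-mono A≼A′ (⊑-hull (A ++ A′) I ⊑-refl)) ⟩
  (len I - measure A I) - (measure A′ I - measure A I)
    ≡⟨ solve 3 (λ l a a′ → (l :- a) :- (a′ :- a) := l :- a′) refl (len I) (measure A I) (measure A′ I) ⟩
  len I - measure A′ I ∎
  where
  open ≤-Reasoning
  Big : Interval
  Big = hull (A ++ A′) I
  A++A′⊑Big : All (_⊑ Big) (A ++ A′)
  A++A′⊑Big = All⊑hull (A ++ A′) I

len>0⇒nonempty : ∀ {a b} → 0ℚ < len (a , b) → a ≤ b
len>0⇒nonempty {a} {b} 0<len with ≤-total a b
... | inj₁ a≤b = a≤b
... | inj₂ b≤a = ⊥-elim (<-irrefl (sym (len-empty b≤a)) 0<len)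

lo-mono-≤ : ∀ x {i k} → i ℕ.≤ k → lo x i ≤ lo x k
lo-mono-≤ x i≤k = go (ℕₚ.≤⇒≤′ i≤k)
  where
  go : ∀ {i k} → i ℕ.≤′ k → lo x i ≤ lo x k
  go ℕ.≤′-refl        = ≤-refl
  go (ℕ.≤′-step i≤′k) = ≤-trans (go i≤′k) (lo-mono x _)

hi-antimono-≤ : ∀ x {i k} → i ℕ.≤ k → hi x k ≤ hi x i
hi-antimono-≤ x i≤k = go (ℕₚ.≤⇒≤′ i≤k)
  where
  go : ∀ {i k} → i ℕ.≤′ k → hi x k ≤ hi x i
  go ℕ.≤′-refl        = ≤-refl
  go (ℕ.≤′-step i≤′k) = ≤-trans (hi-anti x _) (go i≤′k)

lo≤hi′ : ∀ x i j → lo x i ≤ hi x j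
lo≤hi′ x i j =
  ≤-trans (lo-mono-≤ x (ℕₚ.m≤m⊔n i j)) (≤-trans (lo≤hi x (i ℕ.⊔ j)) (hi-antimono-≤ x (ℕₚ.m≤n⊔m i j)))

-- InI i x is x ∈ᴵ pair E i by definition.
_∈ᴵ_ : ℝ → Interval → Set
x ∈ᴵ p = (proj₁ p <ℚℝ x) × (x <ℝℚ proj₂ p)

-- Bisection

module _ (A : ℕ → List Interval) (A-mono : ∀ {m n} → m ℕ.≤ n → Refines (A m) (A n))
         (T : ℕ → ℕ) (A-cauchy : ∀ s {m n} → T s ℕ.≤ m → m ℕ.≤ n → μᴸ (A n) - μᴸ (A m) < 2^- s)
         where

  private module Stages (W : ℚ) (0≤W : 0ℚ ≤ W) where

    -- Beyond m, μᴸ ∘ A grows by less than 2^- (2 + s), a quarter of what A m leaves uncovered in [u , v].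
    record Stage (k : ℕ) : Set where
      constructor stage
      field
        u v : ℚ
        m s : ℕ
        width : v - u ≡ W * 2^- k
        uncovered-large : 2^- s ≤ uncovered (A m) (u , v)
        settled : T (2 ℕ.+ s) ℕ.≤ m
        k≤m : k ℕ.≤ m
    open Stage

    0≤W*2^-k : ∀ k → 0ℚ ≤ W * 2^- k
    0≤W*2^-k k = subst (_≤ W * 2^- k) (*-zeroˡ (2^- k))
                       (*-monoʳ-≤-nonNeg (2^- k) {{nonNegative (<⇒≤ (0<2^-n k))}} 0≤W)

    settle : ∀ {k u′ v′} (S : Stage k) → v′ - u′ ≡ W * 2^- suc k →
             2^- suc (s S) ≤ uncovered (A (m S)) (u′ , v′) → Stage (suc k)
    settle {k} {u′} {v′} S width′ large =
      stage u′ v′ m′ (2 ℕ.+ s S) width′ large′ T≤m′ (ℕ.s≤s (ℕₚ.≤-trans (k≤m S) (ℕₚ.m≤m⊔n (m S) _)))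
      where
      m′ : ℕ
      m′ = suc (m S ℕ.⊔ T (4 ℕ.+ s S))
      m≤m′ : m S ℕ.≤ m′
      m≤m′ = ℕₚ.m≤n⇒m≤1+n (ℕₚ.m≤m⊔n (m S) _)
      T≤m′ : T (4 ℕ.+ s S) ℕ.≤ m′
      T≤m′ = ℕₚ.m≤n⇒m≤1+n (ℕₚ.m≤n⊔m (m S) _)
      large′ : 2^- (2 ℕ.+ s S) ≤ uncovered (A m′) (u′ , v′)
      large′ = begin
        2^- (2 ℕ.+ s S)                                                    ≡⟨ 2^-[1+n]≡2^-n-2^-[1+n] (suc (s S)) ⟩
        2^- (1 ℕ.+ s S) - 2^- (2 ℕ.+ s S)
          ≤⟨ -‿mono-≤ large (<⇒≤ (A-cauchy (2 ℕ.+ s S) (settled S) m≤m′)) ⟩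
        uncovered (A (m S)) (u′ , v′) - (μᴸ (A m′) - μᴸ (A (m S)))
          ≤⟨ uncovered-refines (A-mono m≤m′) (u′ , v′) ⟩
        uncovered (A m′) (u′ , v′)                                         ∎
        where open ≤-Reasoning

    halve : ∀ {k} (S : Stage k) → Σ (Stage (suc k)) λ S′ → u S ≤ u S′ × v S′ ≤ v S
    halve {k} S = [ (λ left  → settle S w-u≡h left  , ≤-refl {u S} , w≤v)
                  , (λ right → settle S v-w≡h right , u≤w , ≤-refl {v S})
                  ]′ (additive-half (uncovered-additive (A (m S))) u≤w w≤v halves-large)
      where
      h w : ℚ
      h = W * 2^- suc k
      w = u S + h
      h+h≡v-u : h + h ≡ v S - u S
      h+h≡v-u = trans (sym (*-distribˡ-+ W (2^- suc k) (2^- suc k)))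
                      (trans (cong (W *_) (2^-[1+n]+2^-[1+n]≡2^-n k)) (sym (width S)))
      w-u≡h : w - u S ≡ h
      w-u≡h = p+q-p≡q (u S) h
      v-w≡h : v S - w ≡ h
      v-w≡h = begin
        v S - (u S + h)    ≡⟨ solve 3 (λ u v h → v :- (u :+ h) := (v :- u) :- h) refl (u S) (v S) h ⟩
        (v S - u S) - h    ≡⟨ cong (_- h) h+h≡v-u ⟨
        (h + h) - h        ≡⟨ p+q-p≡q h h ⟩
        h                  ∎
        where open ≡-Reasoning
      u≤w : u S ≤ w
      u≤w = p≤p+q (u S) (0≤W*2^-k (suc k))
      w≤v : w ≤ v S
      w≤v = 0≤q-p⇒p≤q (subst (0ℚ ≤_) (sym v-w≡h) (0≤W*2^-k (suc k)))
      halves-large : 2^- suc (s S) + 2^- suc (s S) ≤ uncovered (A (m S)) (u S , v S)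
      halves-large = subst (_≤ uncovered (A (m S)) (u S , v S)) (sym (2^-[1+n]+2^-[1+n]≡2^-n (s S))) (uncovered-large S)

    module _ (S₀ : Stage 0) where

      stages : ∀ k → Stage k
      stages zero    = S₀
      stages (suc k) = proj₁ (halve (stages k))

      limit : ℝ
      limit = record
        { lo        = λ k → u (stages k)
        ; hi        = λ k → v (stages k)
        ; lo≤hi     = λ k → 0≤q-p⇒p≤q (subst (0ℚ ≤_) (sym (width (stages k))) (0≤W*2^-k k))
        ; lo-mono   = λ k → proj₁ (proj₂ (halve (stages k)))
        ; hi-anti   = λ k → proj₂ (proj₂ (halve (stages k)))
        ; dwindling = λ j → let (k , W*2^-k<2^-j) = *2^-<2^- W j in
                            k , subst (_< 2^- j) (sym (width (stages k))) W*2^-k<2^-j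
        }

      limit-avoids : ∀ n p → p ∈ A n → ¬ limit ∈ᴵ p
      limit-avoids n p p∈A ((i , q<u) , (j , v<r)) =
        <-irrefl refl (<-≤-trans (0<2^-n (s S)) (≤-trans (uncovered-large S)
          (≤-reflexive (uncovered-covered (A (m S)) (u S , v S) (Any.map (⊑-trans [u,v]⊑p) p⊑A)))))
        where
        k : ℕ
        k = (i ℕ.⊔ j) ℕ.⊔ n
        S : Stage k
        S = stages k
        [u,v]⊑p : (u S , v S) ⊑ p
        [u,v]⊑p = <⇒≤ (<-≤-trans q<u (lo-mono-≤ limit (ℕₚ.≤-trans (ℕₚ.m≤m⊔n i j) (ℕₚ.m≤m⊔n _ n))))
                , <⇒≤ (≤-<-trans (hi-antimono-≤ limit (ℕₚ.≤-trans (ℕₚ.m≤n⊔m i j) (ℕₚ.m≤m⊔n _ n))) v<r)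
        p⊑A : Any (p ⊑_) (A (m S))
        p⊑A = All.lookup (A-mono (ℕₚ.≤-trans (ℕₚ.m≤n⊔m (i ℕ.⊔ j) n) (k≤m S))) p∈A

  avoiding-point : ∀ {u v m s} → 2^- s ≤ uncovered (A m) (u , v) → T (2 ℕ.+ s) ℕ.≤ m →
                   Σ ℝ λ x → u ≤ lo x 0 × hi x 0 ≤ v × (∀ n p → p ∈ A n → ¬ x ∈ᴵ p)
  avoiding-point {u} {v} {m} {s} large settled =
    limit S₀ , ≤-refl , ≤-refl , limit-avoids S₀
    where
    u≤v : u ≤ v
    u≤v = len>0⇒nonempty (<-≤-trans (0<2^-n s) (≤-trans large (uncovered≤len (A m) (u , v))))
    open Stages (v - u) (p≤q⇒0≤q-p u≤v)
    S₀ : Stage 0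
    S₀ = stage u v m s (sym (*-identityʳ (v - u))) large settled ℕ.z≤n

  avoiding-point-inside : ∀ B r {m} → T (3 ℕ.+ r) ℕ.≤ m → sumℚ (replicate (length B) (2^- r)) < μᴸ B - μᴸ (A m) →
                          ∃ λ p → p ∈ B × Σ ℝ λ x → x ∈ᴵ p × (∀ n p → p ∈ A n → ¬ x ∈ᴵ p)
  avoiding-point-inside B r settled t-sum<gain =
    let p , p∈B , (a , b) , (q<a , b<r) , large = uncovered-somewhere-inside (A _) B r t-sum<gain
        x , a≤lo , hi≤b , avoids                 = avoiding-point large settled
    in  p , p∈B , x , ((0 , <-≤-trans q<a a≤lo) , (0 , ≤-<-trans hi≤b b<r)) , avoids

-- Convergent sequences of rationals

-- IsMeasure E α m is Converges (λ n → μ-fin E (initSeg E α n)) m by definition.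
Converges : (ℕ → ℚ) → ℝ → Set
Converges a x = ∀ k → ∃ λ N → ∀ n → N ℕ.≤ n → ((a n - 2^- k) <ℚℝ x) × (x <ℝℚ (a n + 2^- k))

module _ {a : ℕ → ℚ} {x : ℝ} (a→x : Converges a x) where

  modulus : ℕ → ℕ
  modulus k = proj₁ (a→x k)

  converges-below : ∀ k {n} → modulus k ℕ.≤ n → ∀ j → a n < hi x j + 2^- k
  converges-below k N≤n j =
    let i , a-e<lo = proj₁ (proj₂ (a→x k) _ N≤n) in p-r<q⇒p<q+r (<-≤-trans a-e<lo (lo≤hi′ x i j))

  converges-above : ∀ k {n} → modulus k ℕ.≤ n → ∀ j → lo x j < a n + 2^- k
  converges-above k N≤n j =
    let i , hi<a+e = proj₂ (proj₂ (a→x k) _ N≤n) in ≤-<-trans (lo≤hi′ x j i) hi<a+e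

  converges-cauchy : ∀ s {m n} → modulus (suc s) ℕ.≤ m → m ℕ.≤ n → a n - a m < 2^- s
  converges-cauchy s {m} {n} N≤m m≤n = p<q+r⇒p-q<r (begin-strict
    a n              <⟨ converges-below (suc s) (ℕₚ.≤-trans N≤m m≤n) i ⟩
    hi x i + e       <⟨ +-monoˡ-< e hi<a+e ⟩
    (a m + e) + e    ≡⟨ +-assoc (a m) e e ⟩
    a m + (e + e)    ≡⟨ cong (a m +_) (2^-[1+n]+2^-[1+n]≡2^-n s) ⟩
    a m + 2^- s      ∎)
    where
    open ≤-Reasoning
    e : ℚ
    e = 2^- suc s
    i : ℕ
    i = proj₁ (proj₂ (proj₂ (a→x (suc s)) m N≤m))
    hi<a+e : hi x i < a m + e
    hi<a+e = proj₂ (proj₂ (proj₂ (a→x (suc s)) m N≤m))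

limits-separated : ∀ {a b x y} → Converges a x → Converges b y → x <ℝ y →
                   ∃ λ k → ∃ λ N → ∀ {m n} → N ℕ.≤ m → N ℕ.≤ n → 2^- k < b n - a m
limits-separated {a} {b} {x} {y} a→x b→y (i , hi<lo) = suc K , N , separated
  where
  K : ℕ
  K = proj₁ (2^-<pos (p<q⇒0<q-p hi<lo))
  2^-K<gap : 2^- K < lo y i - hi x i
  2^-K<gap = proj₂ (2^-<pos (p<q⇒0<q-p hi<lo))
  Nᵃ Nᵇ N : ℕ
  Nᵃ = modulus {a} {x} a→x (2 ℕ.+ K)
  Nᵇ = modulus {b} {y} b→y (2 ℕ.+ K)
  N  = Nᵃ ℕ.⊔ Nᵇ
  e : ℚ
  e = 2^- (2 ℕ.+ K)
  separated : ∀ {m n} → N ℕ.≤ m → N ℕ.≤ n → 2^- suc K < b n - a m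
  separated {m} {n} N≤m N≤n = begin-strict
    2^- suc K                     ≡⟨ 2^-[1+n]≡2^-n-2^-[1+n] K ⟩
    2^- K - 2^- suc K             ≡⟨ cong (λ z → 2^- K - z) (2^-[1+n]+2^-[1+n]≡2^-n (suc K)) ⟨
    2^- K - (e + e)               <⟨ -‿mono-<-≤ 2^-K<gap (≤-refl {e + e}) ⟩
    (lo y i - hi x i) - (e + e)
      ≡⟨ solve 3 (λ l h e → (l :- h) :- (e :+ e) := (l :- e) :- (h :+ e)) refl (lo y i) (hi x i) e ⟩
    (lo y i - e) - (hi x i + e)
      <⟨ -‿mono-<-≤ (p<q+r⇒p-r<q {lo y i} {b n} {e} (converges-above {b} {y} b→y (2 ℕ.+ K) Nᵇ≤n i))
                    (<⇒≤ (converges-below {a} {x} a→x (2 ℕ.+ K) Nᵃ≤m i)) ⟩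
    b n - a m                     ∎
    where
    open ≤-Reasoning
    Nᵃ≤m : Nᵃ ℕ.≤ m
    Nᵃ≤m = ℕₚ.≤-trans (ℕₚ.m≤m⊔n Nᵃ Nᵇ) N≤m
    Nᵇ≤n : Nᵇ ℕ.≤ n
    Nᵇ≤n = ℕₚ.≤-trans (ℕₚ.m≤n⊔m Nᵃ Nᵇ) N≤n

module _ (E : Enumeration) where

  intervals : (ℕ → ℕ) → ℕ → List Interval
  intervals α n = map (pair E) (initSeg E α n)

  pair∈intervals : ∀ α {j n} → j ℕ.< n → pair E (α j) ∈ intervals α n
  pair∈intervals α j<n = ∈-map⁺ (pair E) (∈-map⁺ α (∈-upTo⁺ j<n))

  ∈intervals⇒pair : ∀ α {n p} → p ∈ intervals α n → ∃ λ j → j ℕ.< n × p ≡ pair E (α j)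
  ∈intervals⇒pair α p∈ with ∈-map⁻ (pair E) p∈
  ... | i , i∈ , refl with ∈-map⁻ α i∈
  ...   | j , j∈ , refl = j , ∈-upTo⁻ j∈ , refl

  intervals-mono : ∀ α {m n} → m ℕ.≤ n → Refines (intervals α m) (intervals α n)
  intervals-mono α {m} {n} m≤n = All.tabulate refines
    where
    refines : ∀ {p} → p ∈ intervals α m → Any (p ⊑_) (intervals α n)
    refines p∈ with ∈intervals⇒pair α p∈
    ... | j , j<m , refl = Any.map (λ { refl → ⊑-refl }) (pair∈intervals α (ℕₚ.<-≤-trans j<m m≤n))

  point-of-difference : ∀ α β mα mβ → IsMeasure E α mα → IsMeasure E β mβ → mα <ℝ mβ →
                        Σ ℝ λ x → H E β x × ¬ H E α x
  point-of-difference α β mα mβ α→mα β→mβ mα<mβ =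
    let k , N , gain = limits-separated {μ α} {μ β} {mα} {mβ} α→mα β→mβ mα<mβ
        B            = intervals β N
        r            = k ℕ.+ length B
        m₀           = N ℕ.⊔ T (3 ℕ.+ r)
        p , p∈B , x , x∈p , avoids =
          avoiding-point-inside (intervals α) (intervals-mono α) T (converges-cauchy {μ α} {mα} α→mα) B r {m₀}
            (ℕₚ.m≤n⊔m N (T (3 ℕ.+ r)))
            (<-trans (sumℚ-replicate-2^- (length B) k) (gain (ℕₚ.m≤m⊔n N (T (3 ℕ.+ r))) ℕₚ.≤-refl))
        j , _ , p≡βj = ∈intervals⇒pair β p∈B
    in  x , (j , subst (x ∈ᴵ_) p≡βj x∈p)
          , λ (i , x∈αi) → avoids (suc i) (pair E (α i)) (pair∈intervals α (ℕₚ.n<1+n i)) x∈αi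
    where
    μ : (ℕ → ℕ) → ℕ → ℚ
    μ γ n = μᴸ (intervals γ n)
    T : ℕ → ℕ
    T s = modulus {μ α} {mα} α→mα (suc s)

  H⊆H⇒≤ℝ : ∀ α β mα mβ → IsMeasure E α mα → IsMeasure E β mβ → (∀ x → H E β x → H E α x) → mβ ≤ℝ mα
  H⊆H⇒≤ℝ α β mα mβ α→mα β→mβ Hβ⊆Hα mα<mβ =
    let x , x∈Hβ , x∉Hα = point-of-difference α β mα mβ α→mα β→mβ mα<mβ in x∉Hα (Hβ⊆Hα x x∈Hβ)

-- Part (i) does not need its hypothesis H α ⊆ H β.
lemma5p8 : (E : Enumeration) (α β : ℕ → ℕ) (mα mβ : ℝ)
    → IsMeasure E α mα → IsMeasure E β mβ
    → ((mα <ℝ mβ) → (∀ x → H E α x → H E β x) → Σ ℝ (λ x → H E β x × ¬ H E α x))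
      × (((∀ x → H E β x → H E α x) → mβ ≤ℝ mα)
        × ((∀ x → (H E β x → H E α x) × (H E α x → H E β x)) → mβ =ℝ mα))
lemma5p8 E α β mα mβ α→mα β→mβ =
    (λ mα<mβ _ → point-of-difference E α β mα mβ α→mα β→mβ mα<mβ)
  , H⊆H⇒≤ℝ E α β mα mβ α→mα β→mβ
  , λ Hβ≡Hα → H⊆H⇒≤ℝ E β α mβ mα β→mβ α→mα (λ x → proj₂ (Hβ≡Hα x))
            , H⊆H⇒≤ℝ E α β mα mβ α→mα β→mβ (λ x → proj₁ (Hβ≡Hα x))
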